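{- Let $H$ be a connected graph of order at least $2$, and let $G$ be obtained from $H$ by adding a vertex-disjoint copy of $K_2$ and an edge joining a vertex of $H$ with a vertex of the added $K_2$. Then (1) $\alpha(G)=\alpha(H)+1$, and (2) $G$ is $\alpha$-excellent if and only if $H$ is $\alpha$-excellent.
   Context: All graphs are finite and simple. $\alpha(G)$ is the independence number. A graph is $\alpha$-excellent if every vertex is contained in some independent set of cardinality equal to the independence number. -}

module Defs where

open import Data.Nat using (ℕ; zero; suc; _≤_)
open import Data.Bool using (Bool; true; false)
open import Data.Fin using (Fin; zero; suc)
open import Data.Fin.Subset using (Subset; _∈_; ∣_∣)
open import Data.Product using (Σ; _×_; _,_)
open import Relation.Binary.PropositionalEquality using (_≡_; refl)
open import Relation.Nullary using (does)
open import Data.Fin using (_≟_)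

record Graph : Set where
  field
    n     : ℕ
    adj   : Fin n → Fin n → Bool
    adj-sym : ∀ u v → adj u v ≡ adj v u
    irrefl : ∀ v → adj v v ≡ false
open Graph public

order : Graph → ℕ
order G = n G

data Walk (G : Graph) : Fin (n G) → Fin (n G) → Set where
  here : ∀ {v} → Walk G v v
  step : ∀ {u w v} → adj G u w ≡ true → Walk G w v → Walk G u v

Connected : Graph → Set
Connected G = ∀ u v → Walk G u v

Independent : (G : Graph) → Subset (n G) → Set
Independent G S = ∀ u v → u ∈ S → v ∈ S → adj G u v ≡ false

IsIndependenceNumber : Graph → ℕ → Set
IsIndependenceNumber G k =
  Σ (Subset (n G)) (λ S → Independent G S × ∣ S ∣ ≡ k)
  × (∀ T → Independent G T → ∣ T ∣ ≤ k)

AlphaExcellent : Graph → Set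
AlphaExcellent G = ∀ k → IsIndependenceNumber G k →
  ∀ v → Σ (Subset (n G)) (λ S → Independent G S × ∣ S ∣ ≡ k × v ∈ S)

-- G obtained from H by adding a disjoint K₂ on new vertices x = zero, y = suc zero,
-- and an edge joining x with the vertex w of H.  Old vertex v of H is suc (suc v).
addPendantK2-adj : (H : Graph) → Fin (n H) → Fin (suc (suc (n H))) → Fin (suc (suc (n H))) → Bool
addPendantK2-adj H w zero zero = false
addPendantK2-adj H w zero (suc zero) = true
addPendantK2-adj H w zero (suc (suc v)) = does (v ≟ w)
addPendantK2-adj H w (suc zero) zero = true
addPendantK2-adj H w (suc zero) (suc zero) = false
addPendantK2-adj H w (suc zero) (suc (suc v)) = false
addPendantK2-adj H w (suc (suc u)) zero = does (u ≟ w)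
addPendantK2-adj H w (suc (suc u)) (suc zero) = false
addPendantK2-adj H w (suc (suc u)) (suc (suc v)) = adj H u v

addPendantK2-sym : (H : Graph) (w : Fin (n H)) → ∀ u v →
  addPendantK2-adj H w u v ≡ addPendantK2-adj H w v u
addPendantK2-sym H w zero zero = refl
addPendantK2-sym H w zero (suc zero) = refl
addPendantK2-sym H w zero (suc (suc v)) = refl
addPendantK2-sym H w (suc zero) zero = refl
addPendantK2-sym H w (suc zero) (suc zero) = refl
addPendantK2-sym H w (suc zero) (suc (suc v)) = refl
addPendantK2-sym H w (suc (suc u)) zero = refl
addPendantK2-sym H w (suc (suc u)) (suc zero) = refl
addPendantK2-sym H w (suc (suc u)) (suc (suc v)) = adj-sym H u v

addPendantK2-irrefl : (H : Graph) (w : Fin (n H)) → ∀ v → addPendantK2-adj H w v v ≡ false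
addPendantK2-irrefl H w zero = refl
addPendantK2-irrefl H w (suc zero) = refl
addPendantK2-irrefl H w (suc (suc v)) = irrefl H v

addPendantK2 : (H : Graph) → Fin (n H) → Graph
addPendantK2 H w = record
  { n = suc (suc (n H))
  ; adj = addPendantK2-adj H w
  ; adj-sym = addPendantK2-sym H w
  ; irrefl = addPendantK2-irrefl H w
  }

{-# OPTIONS --safe #-}
module Submission where

-- Write x, y for the new vertices and w for the vertex of H adjacent to x. An
-- independent set of G meets the edge xy at most once, so α(G) ≤ α(H) + 1, and
-- adding y to any independent set of H gives equality; in particular maximum
-- independent sets of G restrict to maximum independent sets of H. Hence H is
-- α-excellent whenever G is, and conversely every vertex other than x lies in
-- S ∪ {y} for a suitable maximum S of H. For x itself, take a neighbour u of w
-- (which exists as H is connected with at least two vertices) and a maximum S of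
-- H containing u; then w ∉ S, so S ∪ {x} is independent in G.

open import Defs
open import Data.Nat using (ℕ; suc; _≤_; s≤s)
open import Data.Nat.Properties using (≤-refl; ≤-trans; ≤-antisym; n≤1+n)
open import Data.Fin using (Fin; zero; suc; _≟_; punchIn)
open import Data.Fin.Properties using (punchInᵢ≢i)
open import Data.Fin.Subset using (Subset; _∈_; _∉_; ∣_∣)
open import Data.Bool using (true; false)
open import Data.Vec using (_∷_)
open import Data.Vec.Base using (here; there)
open import Data.Product using (Σ; _×_; _,_; proj₂)
open import Relation.Nullary using (contradiction)
open import Relation.Nullary.Decidable using (dec-false)
open import Relation.Binary.PropositionalEquality using (_≡_; _≢_; refl; sym; trans; cong; subst; ≢-sym)

another : ∀ {m} → 2 ≤ m → (i : Fin m) → Σ (Fin m) (i ≢_)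
another {1} (s≤s ()) i
another {suc (suc m)} _ i = punchIn i zero , ≢-sym (punchInᵢ≢i i zero)

walk-first-step : (G : Graph) {u v : Fin (n G)} → Walk G u v → u ≢ v →
  Σ (Fin (n G)) (λ x → adj G u x ≡ true)
walk-first-step G here u≢u = contradiction refl u≢u
walk-first-step G (step {w = x} e _) _ = x , e

connected⇒neighbour : (G : Graph) → Connected G → 2 ≤ order G → ∀ w →
  Σ (Fin (n G)) (λ u → adj G u w ≡ true)
connected⇒neighbour G con 2≤n w with another 2≤n w
... | v , w≢v with walk-first-step G (con w v) w≢v
... | u , e = u , trans (adj-sym G u w) e

independent-∉-neighbour : (G : Graph) {S : Subset (n G)} → Independent G S →
  ∀ {u w} → adj G u w ≡ true → u ∈ S → w ∉ S
independent-∉-neighbour G ind {u} {w} e u∈S w∈S with trans (sym e) (ind u w u∈S w∈S)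
... | ()

module PendantK2 (H : Graph) (w : Fin (n H)) where

  G : Graph
  G = addPendantK2 H w

  restrict-independent : ∀ b₀ b₁ {S : Subset (n H)} → Independent G (b₀ ∷ b₁ ∷ S) → Independent H S
  restrict-independent b₀ b₁ ind u v u∈S v∈S = ind (suc (suc u)) (suc (suc v)) (there (there u∈S)) (there (there v∈S))

  add-y-independent : {S : Subset (n H)} → Independent H S → Independent G (false ∷ true ∷ S)
  add-y-independent ind (suc zero) (suc zero) _ _ = refl
  add-y-independent ind (suc zero) (suc (suc v)) _ _ = refl
  add-y-independent ind (suc (suc u)) (suc zero) _ _ = refl
  add-y-independent ind (suc (suc u)) (suc (suc v)) (there (there u∈S)) (there (there v∈S)) = ind u v u∈S v∈S

  add-x-independent : {S : Subset (n H)} → Independent H S → w ∉ S → Independent G (true ∷ false ∷ S)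
  add-x-independent ind w∉S zero zero _ _ = refl
  add-x-independent ind w∉S zero (suc (suc v)) _ (there (there v∈S)) = dec-false (v ≟ w) (λ { refl → w∉S v∈S })
  add-x-independent ind w∉S (suc (suc u)) zero (there (there u∈S)) _ = dec-false (u ≟ w) (λ { refl → w∉S u∈S })
  add-x-independent ind w∉S (suc (suc u)) (suc (suc v)) (there (there u∈S)) (there (there v∈S)) = ind u v u∈S v∈S

  ∣independent∣≤ : ∀ b₀ b₁ (S : Subset (n H)) → Independent G (b₀ ∷ b₁ ∷ S) → ∣ b₀ ∷ b₁ ∷ S ∣ ≤ suc ∣ S ∣
  ∣independent∣≤ true true S ind with ind zero (suc zero) here (there here)
  ... | ()
  ∣independent∣≤ true false S ind = ≤-refl
  ∣independent∣≤ false true S ind = ≤-refl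
  ∣independent∣≤ false false S ind = n≤1+n _

  α-suc : ∀ a → IsIndependenceNumber H a → IsIndependenceNumber G (suc a)
  α-suc a ((S , ind , ∣S∣≡a) , maxH) = (false ∷ true ∷ S , add-y-independent ind , cong suc ∣S∣≡a) , maxG
    where
    maxG : ∀ T → Independent G T → ∣ T ∣ ≤ suc a
    maxG (b₀ ∷ b₁ ∷ T) indT = ≤-trans (∣independent∣≤ b₀ b₁ T indT) (s≤s (maxH T (restrict-independent b₀ b₁ indT)))

  α-pred : ∀ k → IsIndependenceNumber G k → Σ ℕ (λ a → k ≡ suc a × IsIndependenceNumber H a)
  α-pred k ((b₀ ∷ b₁ ∷ S , ind , ∣S⁺∣≡k) , maxG) = ∣ S ∣ , k≡ , (S , indS , refl) , maxH
    where
    indS : Independent H S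
    indS = restrict-independent b₀ b₁ ind
    k≡ : k ≡ suc ∣ S ∣
    k≡ = ≤-antisym (subst (_≤ suc ∣ S ∣) ∣S⁺∣≡k (∣independent∣≤ b₀ b₁ S ind))
                   (maxG (false ∷ true ∷ S) (add-y-independent indS))
    maxH : ∀ T → Independent H T → ∣ T ∣ ≤ ∣ S ∣
    maxH T indT with s≤s ∣T∣≤∣S∣ ← subst (suc ∣ T ∣ ≤_) k≡ (maxG (false ∷ true ∷ T) (add-y-independent indT)) = ∣T∣≤∣S∣

  excellent⇒excellent-base : AlphaExcellent G → AlphaExcellent H
  excellent⇒excellent-base exG a αH v with exG (suc a) (α-suc a αH) (suc (suc v))
  ... | b₀ ∷ b₁ ∷ S , ind , ∣S⁺∣≡1+a , there (there v∈S) = S , indS , ∣S∣≡a , v∈S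
    where
    indS : Independent H S
    indS = restrict-independent b₀ b₁ ind
    ∣S∣≡a : ∣ S ∣ ≡ a
    ∣S∣≡a with s≤s a≤∣S∣ ← subst (_≤ suc ∣ S ∣) ∣S⁺∣≡1+a (∣independent∣≤ b₀ b₁ S ind) =
      ≤-antisym (proj₂ αH S indS) a≤∣S∣

  excellent-base⇒excellent : Connected H → 2 ≤ order H → AlphaExcellent H → AlphaExcellent G
  excellent-base⇒excellent con 2≤n exH k αG v with α-pred k αG
  ... | a , refl , αH = cover v
    where
    cover : ∀ v → Σ (Subset (n G)) (λ S → Independent G S × ∣ S ∣ ≡ suc a × v ∈ S)
    cover zero with connected⇒neighbour H con 2≤n w
    ... | u , e with exH a αH u
    ... | S , ind , ∣S∣≡a , u∈S =
      true ∷ false ∷ S , add-x-independent ind (independent-∉-neighbour H ind e u∈S) , cong suc ∣S∣≡a , here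
    cover (suc zero) with exH a αH w
    ... | S , ind , ∣S∣≡a , _ = false ∷ true ∷ S , add-y-independent ind , cong suc ∣S∣≡a , there here
    cover (suc (suc v)) with exH a αH v
    ... | S , ind , ∣S∣≡a , v∈S = false ∷ true ∷ S , add-y-independent ind , cong suc ∣S∣≡a , there (there v∈S)

open PendantK2

proposition3p2 : (H : Graph) → Connected H → 2 ≤ order H → (w : Fin (n H)) →
    ((a : ℕ) → IsIndependenceNumber H a → IsIndependenceNumber (addPendantK2 H w) (suc a))
    × ((AlphaExcellent (addPendantK2 H w) → AlphaExcellent H)
       × (AlphaExcellent H → AlphaExcellent (addPendantK2 H w)))
proposition3p2 H con 2≤n w =
  α-suc H w , excellent⇒excellent-base H w , excellent-base⇒excellent H w con 2≤n
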